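{- Let $\sigma\in\mathfrak S_n$ and $1\le i\le n$. Then $i$ is a left-to-right maximum of $\sigma$ (i.e. $\sigma(i)=\max_{1\le l\le i}\sigma(l)$) if and only if the $i$th step of the Laguerre history $\Psi_{FZ}(\sigma)$ is a type 1 step.
   Context: A Laguerre history of size $n$ is a Motzkin path of $n$ steps (steps $\nearrow,\rightarrow,\searrow$ from height $0$ to height $0$, never below $0$) in which each step carries a weight: a step $\nearrow$ starting at height $h$ has weight $yq^i$ for some $i\in\{0,\dots,h\}$; a step $\rightarrow$ starting at height $h$ has weight either $yq^i$ for some $i\in\{0,\dots,h\}$ or $q^i$ for some $i\in\{0,\dots,h-1\}$; a step $\searrow$ starting at height $h$ has weight $q^i$ for some $i\in\{0,\dots,h-1\}$. A type 1 step is a step with weight $yq^h$, and a type 2 step is a step with weight $q^{h-1}$, where $h$ is its starting height. The Foata–Zeilberger map $\Psi_{FZ}$ sends $\sigma\in\mathfrak S_n$ to the Laguerre history whose $i$th step is $\nearrow$ if $\sigma^{ -1}(i)>i<\sigma(i)$, $\searrow$ if $\sigma^{ -1}(i)<i>\sigma(i)$, and $\rightarrow$ otherwise, with weight $y^\delta q^j$ where $\delta=1$ if $i\le\sigma(i)$ and $0$ otherwise, and $j=\#\{k: k<i\le\sigma(k)<\sigma(i)\}$ if $i\le\sigma(i)$, $j=\#\{k:\sigma(i)<\sigma(k)<i<k\}$ if $\sigma(i)<i$. -}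

module Defs where

open import Data.Nat using (ℕ; zero; suc)
open import Data.Integer using (ℤ; _⊖_)
open import Data.Bool using (Bool; true; false)
open import Data.Fin using (Fin; toℕ; _<_; _≤_; _<?_; _≤?_)
open import Data.Fin.Permutation using (Permutation′; _⟨$⟩ʳ_; _⟨$⟩ˡ_)
open import Data.List using (List; length; filter; allFin)
open import Data.Product using (_×_; _,_; proj₁; proj₂)
open import Relation.Nullary using (Dec; yes; no; ¬_)
open import Relation.Nullary.Decidable using (_×-dec_)
open import Relation.Binary.PropositionalEquality using (_≡_)

data Step : Set where
  up level down : Step

-- A weight y^δ q^j is recorded as the pair (δ , j) with δ ∈ {0,1} encoded as a Bool
-- (true = the factor y is present).
Weight : Set
Weight = Bool × ℕ

WStep : Set
WStep = Step × Weight

count : ∀ {n} {P : Fin n → Set} → ((k : Fin n) → Dec (P k)) → ℕ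
count {n} P? = length (filter P? (allFin n))

module _ {n : ℕ} (σ : Permutation′ n) where

  σ⁺ σ⁻ : Fin n → Fin n
  σ⁺ i = σ ⟨$⟩ʳ i
  σ⁻ i = σ ⟨$⟩ˡ i

  fzStep : Fin n → Step
  fzStep i with (i <? σ⁻ i) ×-dec (i <? σ⁺ i)
  ... | yes _ = up
  ... | no _ with (σ⁻ i <? i) ×-dec (σ⁺ i <? i)
  ...   | yes _ = down
  ...   | no _ = level

  fzWeight : Fin n → Weight
  fzWeight i with i ≤? σ⁺ i
  ... | yes _ = true  , count (λ k → (k <? i) ×-dec ((i ≤? σ⁺ k) ×-dec (σ⁺ k <? σ⁺ i)))
  ... | no _  = false , count (λ k → (σ⁺ i <? σ⁺ k) ×-dec ((σ⁺ k <? i) ×-dec (i <? k)))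

  ΨFZ : Fin n → WStep
  ΨFZ i = fzStep i , fzWeight i

isUp? : (s : Step) → Dec (s ≡ up)
isUp? up = yes _≡_.refl
isUp? level = no (λ ())
isUp? down = no (λ ())

isDown? : (s : Step) → Dec (s ≡ down)
isDown? down = yes _≡_.refl
isDown? up = no (λ ())
isDown? level = no (λ ())

startHeight : ∀ {n} → (Fin n → WStep) → Fin n → ℤ
startHeight w i =
  count (λ k → (k <? i) ×-dec isUp? (proj₁ (w k)))
  ⊖ count (λ k → (k <? i) ×-dec isDown? (proj₁ (w k)))

Type1 : ∀ {n} → (Fin n → WStep) → Fin n → Set
Type1 w i = (proj₁ (proj₂ (w i)) ≡ true) × (Data.Integer.+ (proj₂ (proj₂ (w i))) ≡ startHeight w i)

LeftToRightMax : ∀ {n} → Permutation′ n → Fin n → Set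
LeftToRightMax {n} σ i = (l : Fin n) → l ≤ i → (σ ⟨$⟩ʳ l) ≤ (σ ⟨$⟩ʳ i)

-- Read σ as the arcs k ↦ σ k. An up step opens an arc without closing one, a down step closes one
-- without opening one, and a level step does both or neither, so the starting height of step i is
-- the number of arcs k < i ≤ σ k passing over i. When i ≤ σ i the weight exponent counts those arcs
-- with σ k < σ i; hence the step has type 1 exactly when no k < i has σ k > σ i, i.e. when i is a
-- left-to-right maximum. Conversely a left-to-right maximum has i ≤ σ i, because σ maps the i + 1
-- positions l ≤ i injectively to values ≤ σ i.
module Submission where

open import Defs
open import Data.Nat using (ℕ)
open import Data.Fin using (Fin)
open import Data.Fin.Permutation using (Permutation′)
open import Data.Product using (_×_)

open import Data.Bool using (if_then_else_)
open import Data.Nat using (zero; suc; _+_; _∸_; s≤s; s≤s⁻¹)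
import Data.Nat as ℕ
import Data.Nat.Properties as ℕₚ
import Data.Fin as Fin
open import Data.Fin using (toℕ; fromℕ<; inject≤; _<_; _≤_; _<?_; _≤?_)
open import Data.Fin.Properties
  using ( toℕ<n; toℕ-injective; toℕ-inject≤; inject≤-injective; fromℕ<-injective; injective⇒≤
        ; <-cmp; <-irrefl; ≤∧≢⇒<; ≤-antisym)
open import Data.Fin.Permutation using (_⟨$⟩ʳ_; _⟨$⟩ˡ_; inverseˡ; inverseʳ)
import Data.Integer as ℤ
import Data.Integer.Properties as ℤ
open import Data.Integer using (_⊖_)
open import Data.Integer.Properties using (⊖-≥)
open import Data.List using (filter; tabulate; length)
open import Data.Product using (_,_; proj₂)
open import Data.Sum using (inj₁; inj₂)
open import Function using (_∘_; _⇔_; mk⇔; Equivalence)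
open import Function.Definitions using (Injective)
open import Relation.Binary using (tri<; tri≈; tri>)
open import Relation.Binary.PropositionalEquality
open import Relation.Nullary using (Dec; yes; no; does; ¬_; ¬?; contradiction)
open import Relation.Nullary.Decidable using (_×-dec_)
open import Algebra.Properties.CommutativeMonoid.Sum ℕₚ.+-0-commutativeMonoid
  using (sum; sum-cong-≗; sum-permute; sum-replicate-zero; ∑-distrib-+)
open import Algebra.Properties.CommutativeSemigroup ℕₚ.+-commutativeSemigroup using (xy∙z≈xz∙y)

private
  variable
    A B C D P Q R : Set
    n : ℕ

𝟙 : Dec P → ℕ
𝟙 P? = if does P? then 1 else 0

𝟙-yes : (P? : Dec P) → P → 𝟙 P? ≡ 1
𝟙-yes (yes _) _ = refl
𝟙-yes (no ¬p) p = contradiction p ¬p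

𝟙-no : (P? : Dec P) → ¬ P → 𝟙 P? ≡ 0
𝟙-no (yes p) ¬p = contradiction p ¬p
𝟙-no (no _)  _  = refl

𝟙-cong : (P? : Dec P) (Q? : Dec Q) → (P → Q) → (Q → P) → 𝟙 P? ≡ 𝟙 Q?
𝟙-cong P? (yes q) _ g = 𝟙-yes P? (g q)
𝟙-cong P? (no ¬q) f _ = 𝟙-no P? (¬q ∘ f)

𝟙-split : (P? : Dec P) (Q? : Dec Q) → 𝟙 P? ≡ 𝟙 (P? ×-dec Q?) + 𝟙 (P? ×-dec ¬? Q?)
𝟙-split (no _)  _       = refl
𝟙-split (yes _) (yes _) = refl
𝟙-split (yes _) (no _)  = refl

𝟙-restrict : (R? : Dec R) (A? : Dec A) (B? : Dec B) (C? : Dec C) (D? : Dec D) →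
  𝟙 A? + 𝟙 B? ≡ 𝟙 C? + 𝟙 D? →
  𝟙 (R? ×-dec A?) + 𝟙 (R? ×-dec B?) ≡ 𝟙 (R? ×-dec C?) + 𝟙 (R? ×-dec D?)
𝟙-restrict (yes _) _ _ _ _ eq = eq
𝟙-restrict (no _)  _ _ _ _ _  = refl

∑≡0⇒≗0 : (f : Fin n → ℕ) → sum f ≡ 0 → ∀ k → f k ≡ 0
∑≡0⇒≗0 f eq Fin.zero    = ℕₚ.m+n≡0⇒m≡0 (f Fin.zero) eq
∑≡0⇒≗0 f eq (Fin.suc k) = ∑≡0⇒≗0 (f ∘ Fin.suc) (ℕₚ.m+n≡0⇒n≡0 (f Fin.zero) eq) k

module _ {P : Fin n → Set} (P? : ∀ k → Dec (P k)) where

  count≡∑𝟙 : count P? ≡ sum (𝟙 ∘ P?)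
  count≡∑𝟙 = length-filter-tabulate (λ k → k)
    where
    length-filter-tabulate : ∀ {m} (f : Fin m → Fin n) →
      length (filter P? (tabulate f)) ≡ sum (𝟙 ∘ P? ∘ f)
    length-filter-tabulate {zero}  f = refl
    length-filter-tabulate {suc m} f with P? (f Fin.zero)
    ... | yes _ = cong suc (length-filter-tabulate (f ∘ Fin.suc))
    ... | no _  = length-filter-tabulate (f ∘ Fin.suc)

  count≡0⇒∀¬ : count P? ≡ 0 → ∀ k → ¬ P k
  count≡0⇒∀¬ count≡0 k p = contradiction (trans (sym (𝟙-yes (P? k) p)) (∑≡0⇒≗0 (𝟙 ∘ P?) ∑𝟙≡0 k)) λ ()
    where
    ∑𝟙≡0 : sum (𝟙 ∘ P?) ≡ 0
    ∑𝟙≡0 = trans (sym count≡∑𝟙) count≡0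

  ∀¬⇒count≡0 : (∀ k → ¬ P k) → count P? ≡ 0
  ∀¬⇒count≡0 ¬P = trans count≡∑𝟙 (trans (sum-cong-≗ (λ k → 𝟙-no (P? k) (¬P k))) (sum-replicate-zero n))

module _ {P Q : Fin n → Set} (P? : ∀ k → Dec (P k)) (Q? : ∀ k → Dec (Q k)) where

  count-cong : (∀ {k} → P k → Q k) → (∀ {k} → Q k → P k) → count P? ≡ count Q?
  count-cong P⇒Q Q⇒P = begin
    count P?         ≡⟨ count≡∑𝟙 P? ⟩
    sum (𝟙 ∘ P?)     ≡⟨ sum-cong-≗ (λ k → 𝟙-cong (P? k) (Q? k) P⇒Q Q⇒P) ⟩
    sum (𝟙 ∘ Q?)     ≡⟨ count≡∑𝟙 Q? ⟨
    count Q?         ∎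
    where open ≡-Reasoning

  count-split : count P? ≡ count (λ k → P? k ×-dec Q? k) + count (λ k → P? k ×-dec ¬? (Q? k))
  count-split = begin
    count P?                              ≡⟨ count≡∑𝟙 P? ⟩
    sum (𝟙 ∘ P?)                          ≡⟨ sum-cong-≗ (λ k → 𝟙-split (P? k) (Q? k)) ⟩
    sum (λ k → 𝟙 (PQ? k) + 𝟙 (P¬Q? k))    ≡⟨ ∑-distrib-+ (𝟙 ∘ PQ?) (𝟙 ∘ P¬Q?) ⟩
    sum (𝟙 ∘ PQ?) + sum (𝟙 ∘ P¬Q?)        ≡⟨ cong₂ _+_ (count≡∑𝟙 PQ?) (count≡∑𝟙 P¬Q?) ⟨
    count PQ? + count P¬Q?                ∎
    where
    open ≡-Reasoning
    PQ? : ∀ k → Dec (P k × Q k)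
    PQ? k = P? k ×-dec Q? k
    P¬Q? : ∀ k → Dec (P k × ¬ Q k)
    P¬Q? k = P? k ×-dec ¬? (Q? k)

count-restrict-+ : {R A B C D : Fin n → Set} (R? : ∀ k → Dec (R k))
  (A? : ∀ k → Dec (A k)) (B? : ∀ k → Dec (B k)) (C? : ∀ k → Dec (C k)) (D? : ∀ k → Dec (D k)) →
  (∀ k → 𝟙 (A? k) + 𝟙 (B? k) ≡ 𝟙 (C? k) + 𝟙 (D? k)) →
  count (λ k → R? k ×-dec A? k) + count (λ k → R? k ×-dec B? k)
    ≡ count (λ k → R? k ×-dec C? k) + count (λ k → R? k ×-dec D? k)
count-restrict-+ {R = R} {A} {B} {C} {D} R? A? B? C? D? pointwise = begin
  count RA? + count RB?                  ≡⟨ cong₂ _+_ (count≡∑𝟙 RA?) (count≡∑𝟙 RB?) ⟩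
  sum (𝟙 ∘ RA?) + sum (𝟙 ∘ RB?)          ≡⟨ ∑-distrib-+ (𝟙 ∘ RA?) (𝟙 ∘ RB?) ⟨
  sum (λ k → 𝟙 (RA? k) + 𝟙 (RB? k))      ≡⟨ sum-cong-≗ restricted ⟩
  sum (λ k → 𝟙 (RC? k) + 𝟙 (RD? k))      ≡⟨ ∑-distrib-+ (𝟙 ∘ RC?) (𝟙 ∘ RD?) ⟩
  sum (𝟙 ∘ RC?) + sum (𝟙 ∘ RD?)          ≡⟨ cong₂ _+_ (count≡∑𝟙 RC?) (count≡∑𝟙 RD?) ⟨
  count RC? + count RD?                  ∎
  where
  open ≡-Reasoning
  RA? : ∀ k → Dec (R k × A k)
  RA? k = R? k ×-dec A? k
  RB? : ∀ k → Dec (R k × B k)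
  RB? k = R? k ×-dec B? k
  RC? : ∀ k → Dec (R k × C k)
  RC? k = R? k ×-dec C? k
  RD? : ∀ k → Dec (R k × D k)
  RD? k = R? k ×-dec D? k
  restricted : ∀ k → 𝟙 (RA? k) + 𝟙 (RB? k) ≡ 𝟙 (RC? k) + 𝟙 (RD? k)
  restricted k = 𝟙-restrict (R? k) (A? k) (B? k) (C? k) (D? k) (pointwise k)

count-permute : {P : Fin n → Set} (P? : ∀ k → Dec (P k)) (π : Permutation′ n) →
  count P? ≡ count (P? ∘ (π ⟨$⟩ʳ_))
count-permute P? π = begin
  count P?                     ≡⟨ count≡∑𝟙 P? ⟩
  sum (𝟙 ∘ P?)                 ≡⟨ sum-permute (𝟙 ∘ P?) π ⟩
  sum (𝟙 ∘ P? ∘ (π ⟨$⟩ʳ_))     ≡⟨ count≡∑𝟙 (P? ∘ (π ⟨$⟩ʳ_)) ⟨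
  count (P? ∘ (π ⟨$⟩ʳ_))       ∎
  where open ≡-Reasoning

injective-bounded⇒≤ : ∀ {m} {f : Fin m → Fin n} → Injective _≡_ _≡_ f →
  ∀ {i : Fin m} {j : Fin n} → (∀ l → l ≤ i → f l ≤ j) → i ≤ j
injective-bounded⇒≤ {f = f} f-inj {i} {j} bounded = s≤s⁻¹ (injective⇒≤ g-inj)
  where
  ι : Fin (suc (toℕ i)) → Fin _
  ι l = inject≤ l (toℕ<n i)

  ι≤i : ∀ l → ι l ≤ i
  ι≤i l = subst (ℕ._≤ toℕ i) (sym (toℕ-inject≤ l (toℕ<n i))) (s≤s⁻¹ (toℕ<n l))

  g : Fin (suc (toℕ i)) → Fin (suc (toℕ j))
  g l = fromℕ< (s≤s (bounded (ι l) (ι≤i l)))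

  g-inj : Injective _≡_ _≡_ g
  g-inj = inject≤-injective _ _ _ _ ∘ f-inj ∘ toℕ-injective ∘ fromℕ<-injective _ _ _ _

module _ {n : ℕ} (σ : Permutation′ n) where

  σ⁺-injective : Injective _≡_ _≡_ (σ⁺ σ)
  σ⁺-injective σa≡σb = trans (sym (inverseˡ σ)) (trans (cong (σ⁻ σ) σa≡σb) (inverseˡ σ))

  fixed⇒inverse-fixed : ∀ {k} → σ⁺ σ k ≡ k → σ⁻ σ k ≡ k
  fixed⇒inverse-fixed {k} σk≡k = trans (cong (σ⁻ σ) (sym σk≡k)) (inverseˡ σ)

  inverse-fixed⇒fixed : ∀ {k} → σ⁻ σ k ≡ k → σ⁺ σ k ≡ k
  inverse-fixed⇒fixed {k} σ⁻k≡k = trans (cong (σ⁺ σ) (sym σ⁻k≡k)) (inverseʳ σ)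

  excedance⇒σ⁻<self : ∀ {k} → k < σ⁺ σ k → ¬ k < σ⁻ σ k → σ⁻ σ k < k
  excedance⇒σ⁻<self k<σk k≮σ⁻k =
    ≤∧≢⇒< (ℕₚ.≮⇒≥ k≮σ⁻k) (λ σ⁻k≡k → <-irrefl (sym (inverse-fixed⇒fixed σ⁻k≡k)) k<σk)

  fzStep-balance : ∀ k →
    𝟙 (isUp? (fzStep σ k)) + 𝟙 (σ⁻ σ k <? k) ≡ 𝟙 (k <? σ⁺ σ k) + 𝟙 (isDown? (fzStep σ k))
  fzStep-balance k with (k <? σ ⟨$⟩ˡ k) ×-dec (k <? σ ⟨$⟩ʳ k)
  ... | yes (k<σ⁻k , k<σk)
    rewrite 𝟙-no (σ⁻ σ k <? k) (ℕₚ.<-asym k<σ⁻k) | 𝟙-yes (k <? σ⁺ σ k) k<σk = refl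
  ... | no ¬up with (σ ⟨$⟩ˡ k <? k) ×-dec (σ ⟨$⟩ʳ k <? k)
  ...   | yes (σ⁻k<k , σk<k)
    rewrite 𝟙-yes (σ⁻ σ k <? k) σ⁻k<k | 𝟙-no (k <? σ⁺ σ k) (ℕₚ.<-asym σk<k) = refl
  ...   | no ¬down with <-cmp k (σ⁺ σ k)
  ...     | tri< k<σk _ _
    rewrite 𝟙-yes (σ⁻ σ k <? k) (excedance⇒σ⁻<self k<σk (λ k<σ⁻k → ¬up (k<σ⁻k , k<σk)))
          | 𝟙-yes (k <? σ⁺ σ k) k<σk = refl
  ...     | tri≈ _ k≡σk _
    rewrite 𝟙-no (σ⁻ σ k <? k) (<-irrefl (fixed⇒inverse-fixed (sym k≡σk)))
          | 𝟙-no (k <? σ⁺ σ k) (<-irrefl k≡σk) = refl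
  ...     | tri> _ _ σk<k
    rewrite 𝟙-no (σ⁻ σ k <? k) (λ σ⁻k<k → ¬down (σ⁻k<k , σk<k))
          | 𝟙-no (k <? σ⁺ σ k) (ℕₚ.<-asym σk<k) = refl

  arcOver? : (i k : Fin n) → Dec (k < i × i ≤ σ⁺ σ k)
  arcOver? i k = (k <? i) ×-dec (i ≤? σ⁺ σ k)

  arcsOver : Fin n → ℕ
  arcsOver i = count (arcOver? i)

  module _ (i : Fin n) where

    private
      up? : (k : Fin n) → Dec (k < i × fzStep σ k ≡ up)
      down? : (k : Fin n) → Dec (k < i × fzStep σ k ≡ down)
      opener? : (k : Fin n) → Dec (k < i × k < σ⁺ σ k)
      closer? : (k : Fin n) → Dec (k < i × σ⁻ σ k < k)
      up?     k = (k <? i) ×-dec isUp? (fzStep σ k)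
      down?   k = (k <? i) ×-dec isDown? (fzStep σ k)
      opener? k = (k <? i) ×-dec (k <? σ⁺ σ k)
      closer? k = (k <? i) ×-dec (σ⁻ σ k <? k)

      ups downs openers closers : ℕ
      ups     = count up?
      downs   = count down?
      openers = count opener?
      closers = count closer?

    -- An arc opened before i is either still open at i or was closed before i.
    openers≡arcsOver+closers : openers ≡ arcsOver i + closers
    openers≡arcsOver+closers = begin
      openers
        ≡⟨ count-split opener? (λ k → i ≤? σ⁺ σ k) ⟩
      count (λ k → opener? k ×-dec (i ≤? σ⁺ σ k)) + count (λ k → opener? k ×-dec ¬? (i ≤? σ⁺ σ k))
        ≡⟨ cong₂ _+_
             (count-cong (λ k → opener? k ×-dec (i ≤? σ⁺ σ k)) (arcOver? i) stillOpen stillOpen⁻¹)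
             (count-cong (λ k → opener? k ×-dec ¬? (i ≤? σ⁺ σ k)) (closer? ∘ σ⁺ σ) closed closed⁻¹) ⟩
      arcsOver i + count (closer? ∘ σ⁺ σ)
        ≡⟨ cong (arcsOver i +_) (count-permute closer? σ) ⟨
      arcsOver i + closers
        ∎
      where
      open ≡-Reasoning

      stillOpen : ∀ {k} → (k < i × k < σ⁺ σ k) × i ≤ σ⁺ σ k → k < i × i ≤ σ⁺ σ k
      stillOpen ((k<i , _) , i≤σk) = k<i , i≤σk

      stillOpen⁻¹ : ∀ {k} → k < i × i ≤ σ⁺ σ k → (k < i × k < σ⁺ σ k) × i ≤ σ⁺ σ k
      stillOpen⁻¹ (k<i , i≤σk) = (k<i , ℕₚ.<-≤-trans k<i i≤σk) , i≤σk

      closed : ∀ {k} → (k < i × k < σ⁺ σ k) × ¬ i ≤ σ⁺ σ k → σ⁺ σ k < i × σ⁻ σ (σ⁺ σ k) < σ⁺ σ k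
      closed {k} ((_ , k<σk) , i≰σk) = ℕₚ.≰⇒> i≰σk , subst (_< σ⁺ σ k) (sym (inverseˡ σ)) k<σk

      closed⁻¹ : ∀ {k} → σ⁺ σ k < i × σ⁻ σ (σ⁺ σ k) < σ⁺ σ k → (k < i × k < σ⁺ σ k) × ¬ i ≤ σ⁺ σ k
      closed⁻¹ {k} (σk<i , σ⁻σk<σk) =
        (ℕₚ.<-trans k<σk σk<i , k<σk) , ℕₚ.<⇒≱ σk<i
        where
        k<σk : k < σ⁺ σ k
        k<σk = subst (_< σ⁺ σ k) (inverseˡ σ) σ⁻σk<σk

    ups≡arcsOver+downs : ups ≡ arcsOver i + downs
    ups≡arcsOver+downs = ℕₚ.+-cancelʳ-≡ closers ups (arcsOver i + downs) (begin
      ups + closers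
        ≡⟨ count-restrict-+ (_<? i) (isUp? ∘ fzStep σ) (λ k → σ⁻ σ k <? k)
                            (λ k → k <? σ⁺ σ k) (isDown? ∘ fzStep σ) fzStep-balance ⟩
      openers + downs                 ≡⟨ cong (_+ downs) openers≡arcsOver+closers ⟩
      arcsOver i + closers + downs    ≡⟨ xy∙z≈xz∙y (arcsOver i) closers downs ⟩
      arcsOver i + downs + closers    ∎)
      where open ≡-Reasoning

    startHeight-ΨFZ : startHeight (ΨFZ σ) i ≡ ℤ.+ arcsOver i
    startHeight-ΨFZ = begin
      ups ⊖ downs                         ≡⟨ cong (_⊖ downs) ups≡arcsOver+downs ⟩
      (arcsOver i + downs) ⊖ downs        ≡⟨ ⊖-≥ (ℕₚ.m≤n+m downs (arcsOver i)) ⟩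
      ℤ.+ (arcsOver i + downs ∸ downs)    ≡⟨ cong ℤ.+_ (ℕₚ.m+n∸n≡m (arcsOver i) downs) ⟩
      ℤ.+ arcsOver i                      ∎
      where open ≡-Reasoning

  largerBefore? : (i k : Fin n) → Dec (k < i × σ⁺ σ i ≤ σ⁺ σ k)
  largerBefore? i k = (k <? i) ×-dec (σ⁺ σ i ≤? σ⁺ σ k)

  largerBefore : Fin n → ℕ
  largerBefore i = count (largerBefore? i)

  nestedArc? : (i k : Fin n) → Dec (k < i × i ≤ σ⁺ σ k × σ⁺ σ k < σ⁺ σ i)
  nestedArc? i k = (k <? i) ×-dec ((i ≤? σ⁺ σ k) ×-dec (σ⁺ σ k <? σ⁺ σ i))

  arcsOver≡weight+largerBefore : ∀ {i} → i ≤ σ⁺ σ i →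
    arcsOver i ≡ count (nestedArc? i) + largerBefore i
  arcsOver≡weight+largerBefore {i} i≤σi =
    trans (count-split (arcOver? i) (λ k → σ⁺ σ k <? σ⁺ σ i))
          (cong₂ _+_
            (count-cong (λ k → arcOver? i k ×-dec (σ⁺ σ k <? σ⁺ σ i)) (nestedArc? i) reassoc reassoc⁻¹)
            (count-cong (λ k → arcOver? i k ×-dec ¬? (σ⁺ σ k <? σ⁺ σ i)) (largerBefore? i) larger larger⁻¹))
    where
    reassoc : ∀ {k} → (k < i × i ≤ σ⁺ σ k) × σ⁺ σ k < σ⁺ σ i → k < i × i ≤ σ⁺ σ k × σ⁺ σ k < σ⁺ σ i
    reassoc ((k<i , i≤σk) , σk<σi) = k<i , i≤σk , σk<σi

    reassoc⁻¹ : ∀ {k} → k < i × i ≤ σ⁺ σ k × σ⁺ σ k < σ⁺ σ i → (k < i × i ≤ σ⁺ σ k) × σ⁺ σ k < σ⁺ σ i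
    reassoc⁻¹ (k<i , i≤σk , σk<σi) = (k<i , i≤σk) , σk<σi

    larger : ∀ {k} → (k < i × i ≤ σ⁺ σ k) × ¬ σ⁺ σ k < σ⁺ σ i → k < i × σ⁺ σ i ≤ σ⁺ σ k
    larger ((k<i , _) , σk≮σi) = k<i , ℕₚ.≮⇒≥ σk≮σi

    larger⁻¹ : ∀ {k} → k < i × σ⁺ σ i ≤ σ⁺ σ k → (k < i × i ≤ σ⁺ σ k) × ¬ σ⁺ σ k < σ⁺ σ i
    larger⁻¹ (k<i , σi≤σk) = (k<i , ℕₚ.≤-trans i≤σi σi≤σk) , ℕₚ.≤⇒≯ σi≤σk

  Type1-ΨFZ⇔ : ∀ i → Type1 (ΨFZ σ) i ⇔ (i ≤ σ⁺ σ i × largerBefore i ≡ 0)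
  Type1-ΨFZ⇔ i with i ≤? σ ⟨$⟩ʳ i
  ... | no i≰σi = mk⇔ (λ { (() , _) }) (λ (i≤σi , _) → contradiction i≤σi i≰σi)
  ... | yes i≤σi = mk⇔ (λ (_ , weight≡height) → i≤σi , largerBefore≡0 weight≡height)
                       (λ (_ , largerBefore≡0) → refl , weight≡height largerBefore≡0)
    where
    weight : ℕ
    weight = count (nestedArc? i)

    largerBefore≡0 : ℤ.+ weight ≡ startHeight (ΨFZ σ) i → largerBefore i ≡ 0
    largerBefore≡0 weight≡height = ℕₚ.+-cancelˡ-≡ weight (largerBefore i) 0 (begin
      weight + largerBefore i  ≡⟨ arcsOver≡weight+largerBefore i≤σi ⟨
      arcsOver i               ≡⟨ ℤ.+-injective (trans weight≡height (startHeight-ΨFZ i)) ⟨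
      weight                   ≡⟨ ℕₚ.+-identityʳ weight ⟨
      weight + 0               ∎)
      where open ≡-Reasoning

    weight≡height : largerBefore i ≡ 0 → ℤ.+ weight ≡ startHeight (ΨFZ σ) i
    weight≡height largerBefore≡0 = sym (begin
      startHeight (ΨFZ σ) i          ≡⟨ startHeight-ΨFZ i ⟩
      ℤ.+ arcsOver i                 ≡⟨ cong ℤ.+_ (arcsOver≡weight+largerBefore i≤σi) ⟩
      ℤ.+ (weight + largerBefore i)  ≡⟨ cong (λ m → ℤ.+ (weight + m)) largerBefore≡0 ⟩
      ℤ.+ (weight + 0)               ≡⟨ cong ℤ.+_ (ℕₚ.+-identityʳ weight) ⟩
      ℤ.+ weight                     ∎)
      where open ≡-Reasoning

  ltrMax⇒weakExcedance : ∀ {i} → LeftToRightMax σ i → i ≤ σ⁺ σ i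
  ltrMax⇒weakExcedance = injective-bounded⇒≤ σ⁺-injective

  ltrMax⇔largerBefore≡0 : ∀ i → LeftToRightMax σ i ⇔ largerBefore i ≡ 0
  ltrMax⇔largerBefore≡0 i = mk⇔ to from
    where
    to : LeftToRightMax σ i → largerBefore i ≡ 0
    to ltr = ∀¬⇒count≡0 (largerBefore? i) λ k (k<i , σi≤σk) →
      <-irrefl (σ⁺-injective (≤-antisym (ltr k (ℕₚ.<⇒≤ k<i)) σi≤σk)) k<i

    from : largerBefore i ≡ 0 → LeftToRightMax σ i
    from none l l≤i with ℕₚ.m≤n⇒m<n∨m≡n l≤i
    ... | inj₁ l<i = ℕₚ.≮⇒≥ (λ σi<σl → count≡0⇒∀¬ (largerBefore? i) none l (l<i , ℕₚ.<⇒≤ σi<σl))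
    ... | inj₂ l≡i = ℕₚ.≤-reflexive (cong (toℕ ∘ σ⁺ σ) (toℕ-injective l≡i))

lemma3p5 : (n : ℕ) (σ : Permutation′ n) (i : Fin n) →
    (LeftToRightMax σ i → Type1 (ΨFZ σ) i) × (Type1 (ΨFZ σ) i → LeftToRightMax σ i)
lemma3p5 n σ i = ltrMax⇒type1 , type1⇒ltrMax
  where
  open Equivalence

  ltrMax⇒type1 : LeftToRightMax σ i → Type1 (ΨFZ σ) i
  ltrMax⇒type1 ltr =
    from (Type1-ΨFZ⇔ σ i) (ltrMax⇒weakExcedance σ ltr , to (ltrMax⇔largerBefore≡0 σ i) ltr)

  type1⇒ltrMax : Type1 (ΨFZ σ) i → LeftToRightMax σ i
  type1⇒ltrMax type1 = from (ltrMax⇔largerBefore≡0 σ i) (proj₂ (to (Type1-ΨFZ⇔ σ i) type1))
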